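{- Let $I$ be a finite set of indices and, for each $i\in I$, let $\psi_i,\chi_i$ be $\mathsf{Kh}$-free formulas (i.e. propositional formulas). Let $\varphi^+=\bigwedge_{i\in I}\mathsf{Kh}(\psi_i,\chi_i)$ and $\theta^+=\bigwedge_{i\in I}(\mathsf{A}(\neg\psi_i)\lor\mathsf{E}\chi_i)$. Then $\varphi^+$ is satisfiable (in some LTS) if and only if $\theta^+$ is satisfiable (in some $\mathfrak{L}(\mathsf{A})$ model).
   Context: Fix countable sets $\mathsf{Prop}$ of propositional symbols and $\mathsf{Act}$ of action symbols. Formulas of $\mathfrak{L}(\mathsf{Kh})$: $\varphi ::= p \mid \neg\varphi \mid \varphi\lor\varphi \mid \mathsf{Kh}(\varphi,\varphi)$, $p\in\mathsf{Prop}$. An LTS is $\mathfrak{M}=\langle S,(R_a)_{a\in\mathsf{Act}},V\rangle$ with $S\neq\emptyset$, $R_a\subseteq S\times S$, $V:\mathsf{Prop}\to 2^S$. For $\pi\in\mathsf{Act}^*$: $R_\varepsilon=\{(s,s):s\in S\}$, $R_{\pi a}=R_\pi\circ R_a$ (first $R_\pi$, then $R_a$), $R_\pi(X)=\{t:\exists s\in X,(s,t)\in R_\pi\}$. A plan $a_1\dots a_n$ is strongly executable at $s$ iff for all $0\le i<n$ and all $t\in R_{a_1\dots a_i}(s)$, $R_{a_{i+1}}(t)\ne\emptyset$; $\mathrm{SE}(\pi)$ is the set of such states. Truth sets are Boolean as usual on $p,\neg,\lor$, and $[\![\mathsf{Kh}(\varphi,\psi)]\!]=S$ if some $\pi\in\mathsf{Act}^*$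 satisfies $[\![\varphi]\!]\subseteq\mathrm{SE}(\pi)$ and $R_\pi([\![\varphi]\!])\subseteq[\![\psi]\!]$, else $\emptyset$. The logic $\mathfrak{L}(\mathsf{A})$ has formulas $p\mid\neg\varphi\mid\varphi\lor\varphi\mid\mathsf{A}\varphi$, with $\mathsf{E}\varphi:=\neg\mathsf{A}\neg\varphi$, interpreted in models $\langle S,V\rangle$ ($S\neq\emptyset$, $V:\mathsf{Prop}\to2^S$) with $[\![\mathsf{A}\varphi]\!]=S$ if $[\![\varphi]\!]=S$ and $\emptyset$ otherwise. A formula is satisfiable in a logic iff some model of that logic has non-empty truth set for it. -}

module Defs where

open import Data.Nat using (ℕ)
open import Data.Fin using (Fin; zero; suc; toℕ)
open import Data.List using (List; []; _∷_; length; take; lookup)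
open import Data.Product using (Σ; ∃; _×_; _,_)
open import Data.Sum using (_⊎_)
open import Data.Empty using (⊥)
open import Relation.Binary.PropositionalEquality using (_≡_)

Prop : Set
Prop = ℕ

Act : Set
Act = ℕ

data PForm : Set where
  pvar : Prop → PForm
  pneg : PForm → PForm
  por  : PForm → PForm → PForm

data KhForm : Set where
  var : Prop → KhForm
  neg : KhForm → KhForm
  or  : KhForm → KhForm → KhForm
  Kh  : KhForm → KhForm → KhForm

data AForm : Set where
  var : Prop → AForm
  neg : AForm → AForm
  or  : AForm → AForm → AForm
  A   : AForm → AForm

toKh : PForm → KhForm
toKh (pvar p) = var p
toKh (pneg φ) = neg (toKh φ)
toKh (por φ ψ) = or (toKh φ) (toKh ψ)

toA : PForm → AForm
toA (pvar p) = var p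
toA (pneg φ) = neg (toA φ)
toA (por φ ψ) = or (toA φ) (toA ψ)

andKh : KhForm → KhForm → KhForm
andKh φ ψ = neg (or (neg φ) (neg ψ))

topKh : KhForm
topKh = or (var 0) (neg (var 0))

andA : AForm → AForm → AForm
andA φ ψ = neg (or (neg φ) (neg ψ))

topA : AForm
topA = or (var 0) (neg (var 0))

E : AForm → AForm
E φ = neg (A (neg φ))

bigAndKh : (n : ℕ) → (Fin n → KhForm) → KhForm
bigAndKh ℕ.zero f = topKh
bigAndKh (ℕ.suc n) f = andKh (f zero) (bigAndKh n (λ i → f (suc i)))

bigAndA : (n : ℕ) → (Fin n → AForm) → AForm
bigAndA ℕ.zero f = topA
bigAndA (ℕ.suc n) f = andA (f zero) (bigAndA n (λ i → f (suc i)))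

record LTS : Set₁ where
  field
    S   : Set
    s₀  : S                       -- S ≠ ∅
    R   : Act → S → S → Set
    V   : Prop → S → Set

module _ (M : LTS) where
  open LTS M

  Rπ : List Act → S → S → Set
  Rπ [] s t = s ≡ t
  Rπ (a ∷ π) s t = ∃ λ u → R a s u × Rπ π u t

  SE : List Act → S → Set
  SE π s = (i : Fin (length π)) → (t : S) → Rπ (take (toℕ i) π) s t →
           ∃ λ u → R (lookup π i) t u

  sat : KhForm → S → Set
  sat (var p) s = V p s
  sat (neg φ) s = sat φ s → ⊥
  sat (or φ ψ) s = sat φ s ⊎ sat ψ s
  sat (Kh φ ψ) s = ∃ λ (π : List Act) →
    ((t : S) → sat φ t → SE π t) ×
    ((t u : S) → sat φ t → Rπ π t u → sat ψ u)

record AModel : Set₁ where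
  field
    S  : Set
    s₀ : S
    V  : Prop → S → Set

module _ (M : AModel) where
  open AModel M

  satA : AForm → S → Set
  satA (var p) s = V p s
  satA (neg φ) s = satA φ s → ⊥
  satA (or φ ψ) s = satA φ s ⊎ satA ψ s
  satA (A φ) s = (t : S) → satA φ t

SatisfiableKh : KhForm → Set₁
SatisfiableKh φ = Σ LTS λ M → ∃ λ (s : LTS.S M) → sat M φ s

SatisfiableA : AForm → Set₁
SatisfiableA φ = Σ AModel λ M → ∃ λ (s : AModel.S M) → satA M φ s

-- Propositional formulas mean the same in an LTS and in its underlying A-model. A conjunct
-- Kh(ψ, χ) can only hold if every ψ-state has an R_π-successor, which satisfies χ; so ψ is
-- empty or χ is non-empty, i.e. A¬ψ ∨ Eχ. Conversely, over an A-model satisfying every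
-- A¬ψᵢ ∨ Eχᵢ, let action i lead from every state to every χᵢ-state: then Kh(ψᵢ, χᵢ) holds
-- via the empty plan when ψᵢ is empty and via the plan i when χᵢ is non-empty.
-- Constructively all of this happens under a double negation, which a conjunction absorbs.
module Submission where

open import Defs
open import Data.Nat using (ℕ)
open import Data.Fin using (Fin; zero; suc; toℕ)
open import Data.Fin.Properties using (toℕ-injective)
open import Data.Product using (_×_; ∃; _,_)
open import Data.Sum using (_⊎_; inj₁; inj₂)
open import Data.Empty using (⊥-elim)
open import Data.Unit using (⊤; tt)
open import Data.List using (List; []; _∷_)
open import Function using (_∘_; id)
open import Relation.Nullary.Negation using (¬_; contradiction; ¬¬-map; negated-stable)
open import Relation.Binary.PropositionalEquality using (_≡_; refl; cong; cong₂; subst; sym)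

underlying : LTS → AModel
underlying M = record { S = LTS.S M ; s₀ = LTS.s₀ M ; V = LTS.V M }

sat-toKh≡satA-toA : (M : LTS) (φ : PForm) (s : LTS.S M) →
  sat M (toKh φ) s ≡ satA (underlying M) (toA φ) s
sat-toKh≡satA-toA M (pvar p)  s = refl
sat-toKh≡satA-toA M (pneg φ)  s = cong ¬_ (sat-toKh≡satA-toA M φ s)
sat-toKh≡satA-toA M (por φ ψ) s =
  cong₂ _⊎_ (sat-toKh≡satA-toA M φ s) (sat-toKh≡satA-toA M ψ s)

sat-toKh⇒satA-toA : (M : LTS) (φ : PForm) (s : LTS.S M) →
  sat M (toKh φ) s → satA (underlying M) (toA φ) s
sat-toKh⇒satA-toA M φ s = subst id (sat-toKh≡satA-toA M φ s)

satA-toA⇒sat-toKh : (M : LTS) (φ : PForm) (s : LTS.S M) →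
  satA (underlying M) (toA φ) s → sat M (toKh φ) s
satA-toA⇒sat-toKh M φ s = subst id (sym (sat-toKh≡satA-toA M φ s))

module _ (M : LTS) where
  open LTS M

  SE⇒Rπ-nonempty : (π : List Act) (t : S) → SE M π t → ∃ (Rπ M π t)
  SE⇒Rπ-nonempty []      t se = t , refl
  SE⇒Rπ-nonempty (a ∷ π) t se with se zero t refl
  ... | u , tRu with SE⇒Rπ-nonempty π u (λ i v uRv → se (suc i) v (u , tRu , uRv))
  ... | v , uRπv = v , u , tRu , uRπv

  Kh-post-nonempty : (φ ψ : KhForm) (s t : S) →
    sat M (Kh φ ψ) s → sat M φ t → ∃ (sat M ψ)
  Kh-post-nonempty φ ψ s t (π , se , post) φt with SE⇒Rπ-nonempty π t (se t φt)
  ... | u , tRπu = u , post t u φt tRπu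

  Kh-by-empty-plan : (φ ψ : KhForm) (s : S) → (∀ t → ¬ sat M φ t) → sat M (Kh φ ψ) s
  Kh-by-empty-plan φ ψ s ¬φ = [] , (λ t φt ()) , (λ t u φt _ → ⊥-elim (¬φ t φt))

  Kh-by-action : (φ ψ : KhForm) (a : Act) (s : S) →
    (∀ t → ∃ (R a t)) → (∀ t u → R a t u → sat M ψ u) → sat M (Kh φ ψ) s
  Kh-by-action φ ψ a s total into =
      a ∷ []
    , (λ { t φt zero .t refl → total t })
    , (λ { t u φt (v , tRv , refl) → into t v tRv })

  ¬¬sat-bigAndKh⁻ : (n : ℕ) (f : Fin n → KhForm) (s : S) →
    ¬ ¬ sat M (bigAndKh n f) s → ∀ i → ¬ ¬ sat M (f i) s
  ¬¬sat-bigAndKh⁻ (ℕ.suc n) f s h zero    ¬f0 = h (λ conj → conj (inj₁ ¬f0))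
  ¬¬sat-bigAndKh⁻ (ℕ.suc n) f s h (suc i) =
    ¬¬sat-bigAndKh⁻ n (f ∘ suc) s (λ ¬rest → h (λ conj → conj (inj₂ ¬rest))) i

  ¬¬sat-bigAndKh⁺ : (n : ℕ) (f : Fin n → KhForm) (s : S) →
    (∀ i → ¬ ¬ sat M (f i) s) → ¬ ¬ sat M (bigAndKh n f) s
  ¬¬sat-bigAndKh⁺ ℕ.zero    f s h ¬⊤ = ¬⊤ (inj₂ (λ v → ¬⊤ (inj₁ v)))
  ¬¬sat-bigAndKh⁺ (ℕ.suc n) f s h ¬conj = ¬conj λ
    { (inj₁ ¬f0)   → h zero ¬f0
    ; (inj₂ ¬rest) → ¬¬sat-bigAndKh⁺ n (f ∘ suc) s (h ∘ suc) ¬rest }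

module _ (N : AModel) where
  open AModel N

  ¬¬satA-A¬∨E : (φ χ : AForm) (s : S) →
    (∀ t → satA N φ t → ∃ (satA N χ)) → ¬ ¬ satA N (or (A (neg φ)) (E χ)) s
  ¬¬satA-A¬∨E φ χ s post ¬disj =
    ¬disj (inj₁ λ t φt → ¬disj (inj₂ λ A¬χ → let u , χu = post t φt in A¬χ u χu))

  ¬¬satA-bigAndA⁻ : (n : ℕ) (f : Fin n → AForm) (s : S) →
    ¬ ¬ satA N (bigAndA n f) s → ∀ i → ¬ ¬ satA N (f i) s
  ¬¬satA-bigAndA⁻ (ℕ.suc n) f s h zero    ¬f0 = h (λ conj → conj (inj₁ ¬f0))
  ¬¬satA-bigAndA⁻ (ℕ.suc n) f s h (suc i) =
    ¬¬satA-bigAndA⁻ n (f ∘ suc) s (λ ¬rest → h (λ conj → conj (inj₂ ¬rest))) i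

  ¬¬satA-bigAndA⁺ : (n : ℕ) (f : Fin n → AForm) (s : S) →
    (∀ i → ¬ ¬ satA N (f i) s) → ¬ ¬ satA N (bigAndA n f) s
  ¬¬satA-bigAndA⁺ ℕ.zero    f s h ¬⊤ = ¬⊤ (inj₂ (λ v → ¬⊤ (inj₁ v)))
  ¬¬satA-bigAndA⁺ (ℕ.suc n) f s h ¬conj = ¬conj λ
    { (inj₁ ¬f0)   → h zero ¬f0
    ; (inj₂ ¬rest) → ¬¬satA-bigAndA⁺ n (f ∘ suc) s (h ∘ suc) ¬rest }

-- The empty conjunction p₀ ∨ ¬p₀ is not ¬¬-stable, so it is satisfied in a fresh model instead.
satisfiable-bigAndKh : (n : ℕ) (f : Fin n → KhForm) (M : LTS) (s : LTS.S M) →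
  (∀ i → ¬ ¬ sat M (f i) s) → SatisfiableKh (bigAndKh n f)
satisfiable-bigAndKh ℕ.zero    f M s h =
  record { S = ⊤ ; s₀ = tt ; R = λ _ _ _ → ⊤ ; V = λ _ _ → ⊤ } , tt , inj₁ tt
satisfiable-bigAndKh (ℕ.suc n) f M s h =
  M , s , negated-stable (¬¬sat-bigAndKh⁺ M (ℕ.suc n) f s h)

satisfiable-bigAndA : (n : ℕ) (f : Fin n → AForm) (N : AModel) (s : AModel.S N) →
  (∀ i → ¬ ¬ satA N (f i) s) → SatisfiableA (bigAndA n f)
satisfiable-bigAndA ℕ.zero    f N s h =
  record { S = ⊤ ; s₀ = tt ; V = λ _ _ → ⊤ } , tt , inj₁ tt
satisfiable-bigAndA (ℕ.suc n) f N s h =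
  N , s , negated-stable (¬¬satA-bigAndA⁺ N (ℕ.suc n) f s h)

¬¬A¬∨E-of-Kh : (M : LTS) (ψ χ : PForm) (s : LTS.S M) →
  sat M (Kh (toKh ψ) (toKh χ)) s →
  ¬ ¬ satA (underlying M) (or (A (neg (toA ψ))) (E (toA χ))) s
¬¬A¬∨E-of-Kh M ψ χ s kh = ¬¬satA-A¬∨E (underlying M) (toA ψ) (toA χ) s λ t ψt →
  let u , χu = Kh-post-nonempty M (toKh ψ) (toKh χ) s t kh (satA-toA⇒sat-toKh M ψ t ψt)
  in u , sat-toKh⇒satA-toA M χ u χu

postLTS : (n : ℕ) → (Fin n → PForm) → AModel → LTS
postLTS n χ N = record
  { S  = AModel.S N
  ; s₀ = AModel.s₀ N
  ; R  = λ a _ t → ∃ λ (i : Fin n) → toℕ i ≡ a × satA N (toA (χ i)) t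
  ; V  = AModel.V N
  }

¬¬Kh-of-A¬∨E : (n : ℕ) (ψ χ : Fin n → PForm) (N : AModel) (i : Fin n) (s : AModel.S N) →
  satA N (or (A (neg (toA (ψ i)))) (E (toA (χ i)))) s →
  ¬ ¬ sat (postLTS n χ N) (Kh (toKh (ψ i)) (toKh (χ i))) s
¬¬Kh-of-A¬∨E n ψ χ N i s (inj₁ A¬ψ) ¬kh =
  ¬kh (Kh-by-empty-plan L (toKh (ψ i)) (toKh (χ i)) s λ t ψt →
         A¬ψ t (sat-toKh⇒satA-toA L (ψ i) t ψt))
  where L = postLTS n χ N
¬¬Kh-of-A¬∨E n ψ χ N i s (inj₂ Eχ) ¬kh =
  Eχ λ u χu → ¬kh (Kh-by-action L (toKh (ψ i)) (toKh (χ i)) (toℕ i) s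
                     (λ _ → u , i , refl , χu) into)
  where
  L = postLTS n χ N
  into : ∀ t u → LTS.R L (toℕ i) t u → sat L (toKh (χ i)) u
  into t u (j , j≡i , χj) =
    satA-toA⇒sat-toKh L (χ i) u (subst (λ k → satA N (toA (χ k)) u) (toℕ-injective j≡i) χj)

lemma2 : (n : ℕ) (ψ χ : Fin n → PForm) →
    (SatisfiableKh (bigAndKh n (λ i → Kh (toKh (ψ i)) (toKh (χ i))))
      → SatisfiableA (bigAndA n (λ i → or (A (neg (toA (ψ i)))) (E (toA (χ i)))))) ×
    (SatisfiableA (bigAndA n (λ i → or (A (neg (toA (ψ i)))) (E (toA (χ i)))))
      → SatisfiableKh (bigAndKh n (λ i → Kh (toKh (ψ i)) (toKh (χ i)))))
lemma2 n ψ χ = Kh⇒A , A⇒Kh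
  where
  φ⁺ : Fin n → KhForm
  φ⁺ i = Kh (toKh (ψ i)) (toKh (χ i))

  θ⁺ : Fin n → AForm
  θ⁺ i = or (A (neg (toA (ψ i)))) (E (toA (χ i)))

  Kh⇒A : SatisfiableKh (bigAndKh n φ⁺) → SatisfiableA (bigAndA n θ⁺)
  Kh⇒A (M , s , h) = satisfiable-bigAndA n θ⁺ (underlying M) s λ i →
    negated-stable (¬¬-map (¬¬A¬∨E-of-Kh M (ψ i) (χ i) s)
                           (¬¬sat-bigAndKh⁻ M n φ⁺ s (contradiction h) i))

  A⇒Kh : SatisfiableA (bigAndA n θ⁺) → SatisfiableKh (bigAndKh n φ⁺)
  A⇒Kh (N , s , h) = satisfiable-bigAndKh n φ⁺ (postLTS n χ N) s λ i →
    negated-stable (¬¬-map (¬¬Kh-of-A¬∨E n ψ χ N i s)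
                           (¬¬satA-bigAndA⁻ N n θ⁺ s (contradiction h) i))
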